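{- Let $n\ge 2$ be an integer and let $(W_r)_{r\in\mathbb{Z}}$ be any generalized $n$-step Fibonacci sequence. Then for every integer $r$ and every nonnegative integer $k$, \[ \sum_{j=0}^{k}(-1)^jW_{r-k+j}+(n\bmod 2)\sum_{j=0}^{k}(-1)^jW_{r-k-n-1+j} =(-1)^k\sum_{j=1}^{\lceil n/2\rceil}W_{r-2j+1}+\sum_{j=1}^{\lceil n/2\rceil}W_{r-2j-k}. \]
   Context: A generalized $n$-step Fibonacci sequence is any sequence $(W_r)_{r\in\mathbb{Z}}$ of complex numbers satisfying $W_r=\sum_{i=1}^{n}W_{r-i}$ for all $r\in\mathbb{Z}$. Here $n\bmod 2\in\{0,1\}$ is the remainder of $n$ upon division by $2$, and $\lceil q\rceil$ is the least integer $\ge q$. -}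

module Defs where

open import Level using (Level)
open import Data.Nat using (ℕ; zero; suc)
open import Data.Integer using (ℤ)
open import Algebra.Bundles using (CommutativeRing)

module RingSums {c ℓ : Level} (R : CommutativeRing c ℓ) where
  open CommutativeRing R public using (Carrier; _≈_; _+_; _*_; -_; 0#; 1#)

  sumTo : ℕ → (ℕ → Carrier) → Carrier
  sumTo zero    f = f zero
  sumTo (suc k) f = sumTo k f + f (suc k)

  sumFrom1 : ℕ → (ℕ → Carrier) → Carrier
  sumFrom1 zero    f = 0#
  sumFrom1 (suc m) f = sumFrom1 m f + f (suc m)

  sgn : ℕ → Carrier
  sgn zero    = 1#
  sgn (suc j) = - sgn j

  IsNStepFib : ℕ → (ℤ → Carrier) → Set ℓ
  IsNStepFib n W = (r : ℤ) → W r ≈ sumFrom1 n (λ i → W (r Data.Integer.- Data.Integer.+ i))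
    where import Data.Integer

  ofNat : ℕ → Carrier
  ofNat zero    = 0#
  ofNat (suc m) = ofNat m + 1#

{-# OPTIONS --safe #-}

-- Write c = ⌈n/2⌉ and A s = Σ_{j=1}^{c} W_{s-2j+1}, so that A s + A (s-1) = Σ_{i=1}^{2c} W_{s-i}.
-- Since 2c = n + (n mod 2), the recurrence turns this into W_s + (n mod 2) W_{s-n-1}: for odd n
-- the one extra term W_{s-n-1} is exactly the second summand. The left-hand side is the
-- alternating sum of these combinations over s = r-k, …, r, hence the alternating sum of
-- A s + A (s-1), which telescopes to (-1)^k A r + A (r-k-1).
module Submission where

open import Defs
open import Level using (Level)
open import Data.Nat using (ℕ; _≤_; _%_; _/_)
open import Data.Integer using (ℤ; +_; _-_)
import Data.Nat
open import Algebra.Bundles using (CommutativeRing)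

open import Data.Nat as ℕ using (zero; suc; pred; z≤n; s≤s)
import Data.Nat.Properties as ℕ
open import Data.Nat.DivMod using (m/n≡1+[m∸n]/n; m%n<n)
open import Function using (_∘_)
import Data.Integer as ℤ
open import Data.Integer.Properties using (pos-+)
open import Data.Integer.Tactic.RingSolver using (solve-∀)
open import Relation.Binary.PropositionalEquality as ≡ using (_≡_)
import Relation.Binary.Reasoning.Setoid as SetoidReasoning
import Algebra.Properties.CommutativeSemigroup as CommutativeSemigroupProperties

2*⌈n/2⌉≡n+n%2 : ∀ n → 2 ℕ.* ((n ℕ.+ 1) / 2) ≡ n ℕ.+ n % 2
2*⌈n/2⌉≡n+n%2 zero                = ≡.refl
2*⌈n/2⌉≡n+n%2 (suc zero)          = ≡.refl
2*⌈n/2⌉≡n+n%2 (suc (suc n)) = begin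
  2 ℕ.* ((2 ℕ.+ n ℕ.+ 1) / 2)  ≡⟨ ≡.cong (2 ℕ.*_) (m/n≡1+[m∸n]/n {suc (suc n) ℕ.+ 1} (s≤s (s≤s z≤n))) ⟩
  2 ℕ.* suc ((n ℕ.+ 1) / 2)    ≡⟨ ℕ.*-suc 2 ((n ℕ.+ 1) / 2) ⟩
  2 ℕ.+ 2 ℕ.* ((n ℕ.+ 1) / 2)  ≡⟨ ≡.cong (2 ℕ.+_) (2*⌈n/2⌉≡n+n%2 n) ⟩
  2 ℕ.+ (n ℕ.+ n % 2)          ∎
  where open ≡.≡-Reasoning

n%2≤1 : ∀ n → n % 2 ≤ 1
n%2≤1 n = ℕ.≤-pred (m%n<n n 2)

s-x-1≡s-[1+x] : ∀ s x → s - x - + 1 ≡ s - (+ 1 ℤ.+ x)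
s-x-1≡s-[1+x] = solve-∀

s-[1+x]+1≡s-x : ∀ s x → s - (+ 1 ℤ.+ x) ℤ.+ + 1 ≡ s - x
s-[1+x]+1≡s-x = solve-∀

s-1-x+1≡s-x : ∀ s x → (s - + 1) - x ℤ.+ + 1 ≡ s - x
s-1-x+1≡s-x = solve-∀

a-x-1+j≡a+j-x-1 : ∀ a x j → (a - x - + 1) ℤ.+ j ≡ (a ℤ.+ j) - x - + 1
a-x-1+j≡a+j-x-1 = solve-∀

a+j-1≡a-1+j : ∀ a j → (a ℤ.+ j) - + 1 ≡ (a - + 1) ℤ.+ j
a+j-1≡a-1+j = solve-∀

a-1+[1+x]≡a+x : ∀ a x → (a - + 1) ℤ.+ (+ 1 ℤ.+ x) ≡ a ℤ.+ x
a-1+[1+x]≡a+x = solve-∀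

a-x+x≡a : ∀ a x → (a - x) ℤ.+ x ≡ a
a-x+x≡a = solve-∀

r-k-1+0-x+1≡r-x-k : ∀ r k x → ((r - k - + 1) ℤ.+ + 0) - x ℤ.+ + 1 ≡ r - x - k
r-k-1+0-x+1≡r-x-k = solve-∀

s-n-1≡s-[1+n] : ∀ s n → s - + n - + 1 ≡ s - + suc n
s-n-1≡s-[1+n] s n = ≡.trans (s-x-1≡s-[1+x] s (+ n)) (≡.cong (s -_) (≡.sym (pos-+ 1 n)))

s-[1+i]+1≡s-i : ∀ s i → s - + suc i ℤ.+ + 1 ≡ s - + i
s-[1+i]+1≡s-i s i = ≡.trans (≡.cong (λ x → s - x ℤ.+ + 1) (pos-+ 1 i)) (s-[1+x]+1≡s-x s (+ i))

a-1+[1+j]≡a+j : ∀ a j → (a - + 1) ℤ.+ + suc j ≡ a ℤ.+ + j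
a-1+[1+j]≡a+j a j = ≡.trans (≡.cong (λ y → (a - + 1) ℤ.+ y) (pos-+ 1 j)) (a-1+[1+x]≡a+x a (+ j))

[r-k-1]+[1+k]≡r : ∀ r k → (r - + k - + 1) ℤ.+ + suc k ≡ r
[r-k-1]+[1+k]≡r r k = ≡.trans (a-1+[1+j]≡a+j (r - + k) k) (a-x+x≡a r (+ k))

module Sums {c ℓ} (R : CommutativeRing c ℓ) where
  open RingSums R
  open CommutativeRing R
    using (setoid; refl; sym; reflexive; +-cong; +-congˡ; +-congʳ; +-comm; +-assoc;
           +-identityʳ; *-congʳ; *-identityˡ; distribˡ; distribʳ; zeroˡ; -‿inverseʳ;
           +-commutativeSemigroup; *-commutativeSemigroup)
  open CommutativeSemigroupProperties +-commutativeSemigroup using (interchange)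
  open CommutativeSemigroupProperties *-commutativeSemigroup using (x∙yz≈y∙xz)
  open SetoidReasoning setoid

  sumTo-cong : ∀ k {f g : ℕ → Carrier} → (∀ j → f j ≈ g j) → sumTo k f ≈ sumTo k g
  sumTo-cong zero    f≈g = f≈g zero
  sumTo-cong (suc k) f≈g = +-cong (sumTo-cong k f≈g) (f≈g (suc k))

  sumFrom1-cong : ∀ m {f g : ℕ → Carrier} → (∀ j → f (suc j) ≈ g (suc j)) → sumFrom1 m f ≈ sumFrom1 m g
  sumFrom1-cong zero    f≈g = refl
  sumFrom1-cong (suc m) f≈g = +-cong (sumFrom1-cong m f≈g) (f≈g m)

  sumTo-+ : ∀ k (f g : ℕ → Carrier) → sumTo k f + sumTo k g ≈ sumTo k (λ j → f j + g j)
  sumTo-+ zero    f g = refl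
  sumTo-+ (suc k) f g = begin
    (sumTo k f + f (suc k)) + (sumTo k g + g (suc k)) ≈⟨ interchange _ _ _ _ ⟩
    (sumTo k f + sumTo k g) + (f (suc k) + g (suc k)) ≈⟨ +-congʳ (sumTo-+ k f g) ⟩
    sumTo k (λ j → f j + g j) + (f (suc k) + g (suc k)) ∎

  *-distribˡ-sumTo : ∀ x k (f : ℕ → Carrier) → x * sumTo k f ≈ sumTo k (λ j → x * f j)
  *-distribˡ-sumTo x zero    f = refl
  *-distribˡ-sumTo x (suc k) f = begin
    x * (sumTo k f + f (suc k))     ≈⟨ distribˡ x (sumTo k f) (f (suc k)) ⟩
    x * sumTo k f + x * f (suc k)   ≈⟨ +-congʳ (*-distribˡ-sumTo x k f) ⟩
    sumTo k (λ j → x * f j) + x * f (suc k) ∎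

  sumFrom1-odd+even : ∀ m (f : ℕ → Carrier) →
    sumFrom1 m (λ j → f (pred (2 ℕ.* j))) + sumFrom1 m (λ j → f (2 ℕ.* j)) ≈ sumFrom1 (2 ℕ.* m) f
  sumFrom1-odd+even zero    f = +-identityʳ 0#
  sumFrom1-odd+even (suc m) f = begin
    (Odd + f (pred (2 ℕ.* suc m))) + (Even + f (2 ℕ.* suc m)) ≈⟨ interchange _ _ _ _ ⟩
    (Odd + Even) + (f (pred (2 ℕ.* suc m)) + f (2 ℕ.* suc m)) ≈⟨ sym (+-assoc _ _ _) ⟩
    ((Odd + Even) + f (pred (2 ℕ.* suc m))) + f (2 ℕ.* suc m) ≈⟨ +-cong (+-cong (sumFrom1-odd+even m f)
                                                                          (reflexive (≡.cong (f ∘ pred) 2[1+m])))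
                                                                  (reflexive (≡.cong f 2[1+m])) ⟩
    sumFrom1 (2 ℕ.+ 2 ℕ.* m) f                                 ≈⟨ reflexive (≡.cong (λ i → sumFrom1 i f) (≡.sym 2[1+m])) ⟩
    sumFrom1 (2 ℕ.* suc m) f                                   ∎
    where
    Odd  = sumFrom1 m (λ j → f (pred (2 ℕ.* j)))
    Even = sumFrom1 m (λ j → f (2 ℕ.* j))
    2[1+m] : 2 ℕ.* suc m ≡ 2 ℕ.+ 2 ℕ.* m
    2[1+m] = ℕ.*-suc 2 m

  sumTo-linear : ∀ k x (w f h : ℕ → Carrier) →
    sumTo k (λ j → w j * f j) + x * sumTo k (λ j → w j * h j) ≈ sumTo k (λ j → w j * (f j + x * h j))
  sumTo-linear k x w f h = begin
    sumTo k (λ j → w j * f j) + x * sumTo k (λ j → w j * h j)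
      ≈⟨ +-congˡ (*-distribˡ-sumTo x k (λ j → w j * h j)) ⟩
    sumTo k (λ j → w j * f j) + sumTo k (λ j → x * (w j * h j))
      ≈⟨ sumTo-+ k _ _ ⟩
    sumTo k (λ j → w j * f j + x * (w j * h j))
      ≈⟨ sumTo-cong k (λ j → +-congˡ (x∙yz≈y∙xz x (w j) (h j))) ⟩
    sumTo k (λ j → w j * f j + w j * (x * h j))
      ≈⟨ sumTo-cong k (λ j → sym (distribˡ (w j) (f j) (x * h j))) ⟩
    sumTo k (λ j → w j * (f j + x * h j)) ∎

  alternating-telescope : ∀ k (g : ℕ → Carrier) →
    sumTo k (λ j → sgn j * (g (suc j) + g j)) ≈ sgn k * g (suc k) + g 0
  alternating-telescope zero    g = begin
    1# * (g 1 + g 0)   ≈⟨ *-identityˡ _ ⟩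
    g 1 + g 0          ≈⟨ +-congʳ (sym (*-identityˡ _)) ⟩
    1# * g 1 + g 0     ∎
  alternating-telescope (suc k) g = begin
    sumTo k (λ j → sgn j * (g (suc j) + g j)) + - s * (g (2 ℕ.+ k) + g (suc k))
      ≈⟨ +-congʳ (alternating-telescope k g) ⟩
    (s * g (suc k) + g 0) + - s * (g (2 ℕ.+ k) + g (suc k))
      ≈⟨ +-congˡ (distribˡ (- s) _ _) ⟩
    (s * g (suc k) + g 0) + (- s * g (2 ℕ.+ k) + - s * g (suc k))
      ≈⟨ +-congʳ (+-comm _ _) ⟩
    (g 0 + s * g (suc k)) + (- s * g (2 ℕ.+ k) + - s * g (suc k))
      ≈⟨ interchange _ _ _ _ ⟩
    (g 0 + - s * g (2 ℕ.+ k)) + (s * g (suc k) + - s * g (suc k))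
      ≈⟨ +-congˡ cancel ⟩
    (g 0 + - s * g (2 ℕ.+ k)) + 0#
      ≈⟨ +-identityʳ _ ⟩
    g 0 + - s * g (2 ℕ.+ k)
      ≈⟨ +-comm _ _ ⟩
    - s * g (2 ℕ.+ k) + g 0 ∎
    where
    s = sgn k
    cancel : s * g (suc k) + - s * g (suc k) ≈ 0#
    cancel = begin
      s * g (suc k) + - s * g (suc k) ≈⟨ sym (distribʳ _ s (- s)) ⟩
      (s + - s) * g (suc k)           ≈⟨ *-congʳ (-‿inverseʳ s) ⟩
      0# * g (suc k)                  ≈⟨ zeroˡ _ ⟩
      0#                              ∎


module NStepFibonacci {c ℓ} (R : CommutativeRing c ℓ) (n : ℕ) (W : ℤ → RingSums.Carrier R)
                      (fib : RingSums.IsNStepFib R n W) where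
  open RingSums R
  open CommutativeRing R
    using (setoid; sym; trans; reflexive; +-cong; +-congˡ; *-congˡ; *-congʳ;
           +-identityˡ; +-identityʳ; *-identityˡ; zeroˡ)
  open Sums R
  open SetoidReasoning setoid

  W-≡ : ∀ {a b} → a ≡ b → W a ≈ W b
  W-≡ = reflexive ∘ ≡.cong W

  sumFrom1-W-≡ : ∀ {a b} s → a ≡ b → sumFrom1 a (λ i → W (s - + i)) ≈ sumFrom1 b (λ i → W (s - + i))
  sumFrom1-W-≡ s a≡b = reflexive (≡.cong (λ m → sumFrom1 m (λ i → W (s - + i))) a≡b)

  recurrence-extended : ∀ {b} → b ≤ 1 → ∀ s →
    W s + ofNat b * W (s - + n - + 1) ≈ sumFrom1 (n ℕ.+ b) (λ i → W (s - + i))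
  recurrence-extended z≤n s = begin
    W s + 0# * W (s - + n - + 1)           ≈⟨ +-congˡ (zeroˡ _) ⟩
    W s + 0#                               ≈⟨ +-identityʳ (W s) ⟩
    W s                                    ≈⟨ fib s ⟩
    sumFrom1 n (λ i → W (s - + i))         ≈⟨ sumFrom1-W-≡ s (≡.sym (ℕ.+-identityʳ n)) ⟩
    sumFrom1 (n ℕ.+ 0) (λ i → W (s - + i)) ∎
  recurrence-extended (s≤s z≤n) s = begin
    W s + (0# + 1#) * W (s - + n - + 1)    ≈⟨ +-congˡ (*-congʳ (+-identityˡ 1#)) ⟩
    W s + 1# * W (s - + n - + 1)           ≈⟨ +-congˡ (*-identityˡ _) ⟩
    W s + W (s - + n - + 1)                ≈⟨ +-cong (fib s) (W-≡ (s-n-1≡s-[1+n] s n)) ⟩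
    sumFrom1 (suc n) (λ i → W (s - + i))   ≈⟨ sumFrom1-W-≡ s (ℕ.+-comm 1 n) ⟩
    sumFrom1 (n ℕ.+ 1) (λ i → W (s - + i)) ∎

  twisted : ℤ → Carrier
  twisted x = W x + ofNat (n % 2) * W (x - + n - + 1)

  skipSum : ℤ → Carrier
  skipSum s = sumFrom1 ((n ℕ.+ 1) / 2) (λ j → W (s - + (2 ℕ.* j) ℤ.+ + 1))

  skipSum-≡ : ∀ {a b} → a ≡ b → skipSum a ≈ skipSum b
  skipSum-≡ = reflexive ∘ ≡.cong skipSum

  twisted≈skipSum+skipSum : ∀ s → twisted s ≈ skipSum s + skipSum (s - + 1)
  twisted≈skipSum+skipSum s = begin
    twisted s                                            ≈⟨ recurrence-extended (n%2≤1 n) s ⟩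
    sumFrom1 (n ℕ.+ n % 2) W[s-_]                        ≈⟨ sumFrom1-W-≡ s (≡.sym (2*⌈n/2⌉≡n+n%2 n)) ⟩
    sumFrom1 (2 ℕ.* ⌈n/2⌉) W[s-_]                        ≈⟨ sym (sumFrom1-odd+even ⌈n/2⌉ W[s-_]) ⟩
    sumFrom1 ⌈n/2⌉ (λ j → W[s- pred (2 ℕ.* j) ])
      + sumFrom1 ⌈n/2⌉ (λ j → W[s- 2 ℕ.* j ])           ≈⟨ +-cong (sumFrom1-cong ⌈n/2⌉ odd) (sumFrom1-cong ⌈n/2⌉ even) ⟩
    skipSum s + skipSum (s - + 1)                        ∎
    where
    ⌈n/2⌉ = (n ℕ.+ 1) / 2
    W[s-_] : ℕ → Carrier
    W[s- i ] = W (s - + i)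
    odd : ∀ j → W[s- pred (2 ℕ.* suc j) ] ≈ W (s - + (2 ℕ.* suc j) ℤ.+ + 1)
    odd j = W-≡ (≡.sym (s-[1+i]+1≡s-i s (pred (2 ℕ.* suc j))))
    even : ∀ j → W[s- 2 ℕ.* suc j ] ≈ W ((s - + 1) - + (2 ℕ.* suc j) ℤ.+ + 1)
    even j = W-≡ (≡.sym (s-1-x+1≡s-x s (+ (2 ℕ.* suc j))))

  skipSum[r-k-1+0]≈Σ : ∀ r k →
    skipSum ((r - + k - + 1) ℤ.+ + 0) ≈ sumFrom1 ((n ℕ.+ 1) / 2) (λ j → W (r - + (2 ℕ.* j) - + k))
  skipSum[r-k-1+0]≈Σ r k =
    sumFrom1-cong ((n ℕ.+ 1) / 2) (λ j → W-≡ (r-k-1+0-x+1≡r-x-k r (+ k) (+ (2 ℕ.* suc j))))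

  alternating-sum-twisted : ∀ r k →
    sumTo k (λ j → sgn j * W ((r - + k) ℤ.+ + j))
      + ofNat (n % 2) * sumTo k (λ j → sgn j * W ((r - + k - + n - + 1) ℤ.+ + j))
    ≈ sumTo k (λ j → sgn j * twisted ((r - + k) ℤ.+ + j))
  alternating-sum-twisted r k =
    trans (+-congˡ (*-congˡ (sumTo-cong k (λ j → *-congˡ (W-≡ (shift j))))))
          (sumTo-linear k (ofNat (n % 2)) sgn _ _)
    where
    shift : ∀ j → (r - + k - + n - + 1) ℤ.+ + j ≡ ((r - + k) ℤ.+ + j) - + n - + 1
    shift j = a-x-1+j≡a+j-x-1 (r - + k) (+ n) (+ j)

theorem2 : ∀ {c ℓ} (R : CommutativeRing c ℓ) → let open RingSums R in
    (n : ℕ) → 2 ≤ n → (W : ℤ → Carrier) → IsNStepFib n W →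
    (r : ℤ) (k : ℕ) →
    (sumTo k (λ j → sgn j * W ((r - + k) Data.Integer.+ + j))
       + ofNat (n % 2) * sumTo k (λ j → sgn j * W ((r - + k - + n - + 1) Data.Integer.+ + j)))
    ≈ (sgn k * sumFrom1 ((n Data.Nat.+ 1) / 2) (λ j → W (r - + (2 Data.Nat.* j) Data.Integer.+ + 1))
       + sumFrom1 ((n Data.Nat.+ 1) / 2) (λ j → W (r - + (2 Data.Nat.* j) - + k)))
theorem2 R n _ W fib r k = begin
  _                                          ≈⟨ alternating-sum-twisted r k ⟩
  sumTo k (λ j → sgn j * twisted (x j))      ≈⟨ sumTo-cong k (λ j → *-congˡ (twisted≈g[1+j]+g[j] j)) ⟩
  sumTo k (λ j → sgn j * (g (suc j) + g j))  ≈⟨ alternating-telescope k g ⟩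
  sgn k * g (suc k) + g 0                    ≈⟨ +-cong (*-congˡ (skipSum-≡ ([r-k-1]+[1+k]≡r r k)))
                                                       (skipSum[r-k-1+0]≈Σ r k) ⟩
  _                                          ∎
  where
  open RingSums R
  open CommutativeRing R using (setoid; trans; +-cong; *-congˡ)
  open Sums R
  open NStepFibonacci R n W fib
  open SetoidReasoning setoid

  x : ℕ → ℤ
  x j = (r - + k) ℤ.+ + j

  g : ℕ → Carrier
  g j = skipSum ((r - + k - + 1) ℤ.+ + j)

  twisted≈g[1+j]+g[j] : ∀ j → twisted (x j) ≈ g (suc j) + g j
  twisted≈g[1+j]+g[j] j =
    trans (twisted≈skipSum+skipSum (x j))
          (+-cong (skipSum-≡ (≡.sym (a-1+[1+j]≡a+j (r - + k) j))) (skipSum-≡ (a+j-1≡a-1+j (r - + k) (+ j))))
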